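{- Let $\mathcal{M}=(\mathcal{E},\mathcal{I})$ be a matroid with distinct weights $w\in\mathbb{R}_+^{\mathcal{E}}$, and let $S,F\subseteq\mathcal{E}$. Then $|F\cap\mathrm{OPT}_w(S\cup F)|\ge|F\cap\mathrm{OPT}_w(S)|$.
   Context: $\mathrm{OPT}_w(A)$ is the unique maximum-weight independent subset of $A$ of minimum cardinality (excluding zero-weight elements). -}

module Defs where

open import Level using (0ℓ)
open import Data.Bool using (Bool; true; false)
open import Data.Nat using (ℕ; zero; suc; _<_) renaming (_≤_ to _≤ℕ_)
open import Data.Fin using (Fin; zero; suc)
open import Data.Fin.Subset using (Subset; _⊆_; _∪_; _∩_; ∣_∣; _∈_; _∉_; ⁅_⁆; ⊥)
open import Data.Vec using ([]; _∷_)
open import Data.Product using (Σ; _×_; ∃)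
open import Relation.Binary.PropositionalEquality using (_≡_)
open import Relation.Binary.Structures using (IsTotalOrder)
open import Algebra.Structures using (IsAbelianGroup)

-- A totally ordered abelian group (e.g. (ℝ, +, ≤)), used as the codomain
-- of the weights since agda-stdlib has no real numbers.
record OrderedAbGroup : Set₁ where
  field
    Carrier      : Set
    _+_          : Carrier → Carrier → Carrier
    0#           : Carrier
    -_           : Carrier → Carrier
    _≤_          : Carrier → Carrier → Set
    isAbelianGroup : IsAbelianGroup _≡_ _+_ 0# -_
    isTotalOrder   : IsTotalOrder _≡_ _≤_
    +-mono-≤     : ∀ {a b} c → a ≤ b → (a + c) ≤ (b + c)

record Matroid (n : ℕ) : Set₁ where
  field
    Indep    : Subset n → Set
    indep-⊥  : Indep ⊥
    indep-⊆  : ∀ {I J} → I ⊆ J → Indep J → Indep I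
    exchange : ∀ {I J} → Indep I → Indep J → ∣ I ∣ < ∣ J ∣ →
               ∃ λ x → x ∈ J × x ∉ I × Indep (⁅ x ⁆ ∪ I)

module _ (G : OrderedAbGroup) where
  open OrderedAbGroup G

  wsum : ∀ {n} → (Fin n → Carrier) → Subset n → Carrier
  wsum {zero}  w []            = 0#
  wsum {suc n} w (true  ∷ p)   = w zero + wsum (λ i → w (suc i)) p
  wsum {suc n} w (false ∷ p)   = wsum (λ i → w (suc i)) p

  record IsOPT {n} (M : Matroid n) (w : Fin n → Carrier) (A O : Subset n) : Set where
    open Matroid M
    field
      O⊆A     : O ⊆ A
      O-indep : Indep O
      maxW    : ∀ J → J ⊆ A → Indep J → wsum w J ≤ wsum w O
      minCard : ∀ J → J ⊆ A → Indep J → wsum w J ≡ wsum w O → ∣ O ∣ ≤ℕ ∣ J ∣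

module Submission where

-- Let O₁ = OPT_w(S ∪ F) and O₂ = OPT_w(S).  For ground sets A ⊆ B we prove
--   (size)     ∣ OPT(A) ∣ ≤ ∣ OPT(B) ∣       (OPT-size-mono), and
--   (restrict) OPT(B) ∩ A ⊆ OPT(A)           (OPT-restrict).
-- Then ∁F ∩ O₁ ⊆ O₂ by (restrict), since O₁ ⊆ S ∪ F; together with
-- ∣ O₂ ∣ ≤ ∣ O₁ ∣ this bounds ∣ F ∩ O₂ ∣ by ∣ F ∩ O₁ ∣ (∣F∩q∣≤∣F∩p∣).
--
-- Both rest on the rank of upper segments (upper-rank): if the elements of
-- T have non-zero weight and no element of O = OPT(A) outside T outweighs an
-- element of T, then O ∩ T is a largest independent subset of A ∩ T.  This
-- follows from the exchange and augmentation properties of matroids and two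
-- local optimality facts: OPT(A) cannot be extended by a non-zero element,
-- nor trade an element for a heavier one (distinct weights make "not
-- heavier" mean "not different").  (size) uses T = OPT(A) ∪ OPT(B);
-- (restrict) uses the elements heavier than, resp. at least as heavy as, e.

open import Defs
open import Data.Nat using (ℕ; _≤_)
open import Data.Fin using (Fin)
open import Data.Fin.Subset using (Subset; _∪_; _∩_; ∣_∣)
open import Relation.Binary.PropositionalEquality using (_≡_)
open import Function.Definitions using (Injective)

open import Data.Empty using (⊥-elim)
open import Data.Fin using (zero; suc; _≟_)
open import Data.Fin.Properties using (any?)
open import Data.Fin.Subset using (_⊆_; _∈_; _∉_; ⁅_⁆; ∁; _-_; inside; outside)
open import Data.Fin.Subset.Properties
  using ( _∈?_; ⊆-refl; x∈⁅x⁆; x∈⁅y⁆⇒x≡y; ∪-identityˡ; p⊆p∪q; q⊆p∪q; x∈p∪q⁺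
        ; x∈p∪q⁻; p∩q⊆p; p∩q⊆q; x∈p∩q⁺; x∈p∩q⁻; ∣p∩q∣≤∣p∣; x∈∁p⇒x∉p
        ; p⊆q⇒∣p∣≤∣q∣; p⊂q⇒∣p∣<∣q∣; p─⊥≡p; p─q⊆p; x∈p∧x≢y⇒x∈p-y
        ; x∈p⇒∣p-x∣<∣p∣ )
open import Data.Nat using (zero; suc; _+_; _<_)
open import Data.Nat.Properties
  using (≤-trans; ≤-reflexive; <⇒≱; ≰⇒>; _≤?_; +-suc; m≤m+n; +-monoʳ-≤; +-cancelʳ-≤)
open import Data.Product using (∃; _×_; _,_)
open import Data.Sum using (_⊎_; inj₁; inj₂)
open import Data.Vec using ([]; _∷_; tabulate; here; there)
open import Data.Vec.Properties using (lookup∘tabulate; lookup⇒[]=; []=⇒lookup)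
open import Function using (_∘_)
open import Relation.Nullary using (¬_; Dec; yes; no; does; contradiction)
open import Relation.Nullary.Decidable using (_×-dec_; ¬?; decidable-stable; dec-true)
open import Relation.Binary.PropositionalEquality
  using (_≢_; refl; sym; trans; cong; subst; subst₂; module ≡-Reasoning)
open import Relation.Binary.Structures using (IsTotalOrder)
open import Algebra.Structures using (IsAbelianGroup)

private
  variable
    n : ℕ
    x y : Fin n
    p q r : Subset n

∪-⊆ : p ⊆ r → q ⊆ r → p ∪ q ⊆ r
∪-⊆ {p = p} {q = q} p⊆r q⊆r x∈p∪q with x∈p∪q⁻ p q x∈p∪q
... | inj₁ x∈p = p⊆r x∈p
... | inj₂ x∈q = q⊆r x∈q

x∈⁅x⁆∪p : ∀ (p : Subset n) → x ∈ ⁅ x ⁆ ∪ p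
x∈⁅x⁆∪p {x = x} p = x∈p∪q⁺ (inj₁ (x∈⁅x⁆ x))

∈⁅x⁆∪p⁻ : ∀ (p : Subset n) → y ∈ ⁅ x ⁆ ∪ p → y ≡ x ⊎ y ∈ p
∈⁅x⁆∪p⁻ {x = x} p y∈ with x∈p∪q⁻ ⁅ x ⁆ p y∈
... | inj₁ y∈⁅x⁆ = inj₁ (x∈⁅y⁆⇒x≡y x y∈⁅x⁆)
... | inj₂ y∈p   = inj₂ y∈p

⁅x⁆∪p⊆q : x ∈ q → p ⊆ q → ⁅ x ⁆ ∪ p ⊆ q
⁅x⁆∪p⊆q {x = x} {q = q} x∈q = ∪-⊆ (λ y∈⁅x⁆ → subst (_∈ q) (sym (x∈⁅y⁆⇒x≡y x y∈⁅x⁆)) x∈q)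

∣⁅x⁆∪p∣≡1+∣p∣ : ∀ (x : Fin n) p → x ∉ p → ∣ ⁅ x ⁆ ∪ p ∣ ≡ suc ∣ p ∣
∣⁅x⁆∪p∣≡1+∣p∣ zero    (outside ∷ p) _   = cong (suc ∘ ∣_∣) (∪-identityˡ p)
∣⁅x⁆∪p∣≡1+∣p∣ zero    (inside  ∷ p) x∉p = contradiction here x∉p
∣⁅x⁆∪p∣≡1+∣p∣ (suc x) (outside ∷ p) x∉p = ∣⁅x⁆∪p∣≡1+∣p∣ x p (x∉p ∘ there)
∣⁅x⁆∪p∣≡1+∣p∣ (suc x) (inside  ∷ p) x∉p = cong suc (∣⁅x⁆∪p∣≡1+∣p∣ x p (x∉p ∘ there))

⊆⊎∃∉ : ∀ (p q : Subset n) → p ⊆ q ⊎ ∃ λ x → x ∈ p × x ∉ q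
⊆⊎∃∉ p q with any? (λ x → (x ∈? p) ×-dec ¬? (x ∈? q))
... | yes (x , x∈p , x∉q) = inj₂ (x , x∈p , x∉q)
... | no none = inj₁ λ {x} x∈p → decidable-stable (x ∈? q) (λ x∉q → none (x , x∈p , x∉q))

⊆-card-⊇ : p ⊆ q → ∣ q ∣ ≤ ∣ p ∣ → q ⊆ p
⊆-card-⊇ {p = p} {q = q} p⊆q ∣q∣≤∣p∣ with ⊆⊎∃∉ q p
... | inj₁ q⊆p = q⊆p
... | inj₂ (x , x∈q , x∉p) = contradiction ∣q∣≤∣p∣ (<⇒≱ (p⊂q⇒∣p∣<∣q∣ (p⊆q , x , x∈q , x∉p)))

∣p∣≡∣F∩p∣+∣∁F∩p∣ : ∀ (F p : Subset n) → ∣ p ∣ ≡ ∣ F ∩ p ∣ + ∣ ∁ F ∩ p ∣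
∣p∣≡∣F∩p∣+∣∁F∩p∣ []            []            = refl
∣p∣≡∣F∩p∣+∣∁F∩p∣ (inside  ∷ F) (inside  ∷ p) = cong suc (∣p∣≡∣F∩p∣+∣∁F∩p∣ F p)
∣p∣≡∣F∩p∣+∣∁F∩p∣ (outside ∷ F) (inside  ∷ p) =
  trans (cong suc (∣p∣≡∣F∩p∣+∣∁F∩p∣ F p)) (sym (+-suc _ _))
∣p∣≡∣F∩p∣+∣∁F∩p∣ (inside  ∷ F) (outside ∷ p) = ∣p∣≡∣F∩p∣+∣∁F∩p∣ F p
∣p∣≡∣F∩p∣+∣∁F∩p∣ (outside ∷ F) (outside ∷ p) = ∣p∣≡∣F∩p∣+∣∁F∩p∣ F p

∣F∩q∣≤∣F∩p∣ : ∀ (F : Subset n) → ∣ q ∣ ≤ ∣ p ∣ → ∁ F ∩ p ⊆ ∁ F ∩ q → ∣ F ∩ q ∣ ≤ ∣ F ∩ p ∣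
∣F∩q∣≤∣F∩p∣ {q = q} {p = p} F ∣q∣≤∣p∣ outside⊆ = +-cancelʳ-≤ ∣ ∁ F ∩ q ∣ _ _ (begin
  ∣ F ∩ q ∣ + ∣ ∁ F ∩ q ∣  ≡⟨ sym (∣p∣≡∣F∩p∣+∣∁F∩p∣ F q) ⟩
  ∣ q ∣                    ≤⟨ ∣q∣≤∣p∣ ⟩
  ∣ p ∣                    ≡⟨ ∣p∣≡∣F∩p∣+∣∁F∩p∣ F p ⟩
  ∣ F ∩ p ∣ + ∣ ∁ F ∩ p ∣  ≤⟨ +-monoʳ-≤ ∣ F ∩ p ∣ (p⊆q⇒∣p∣≤∣q∣ outside⊆) ⟩
  ∣ F ∩ p ∣ + ∣ ∁ F ∩ q ∣  ∎)
  where open Data.Nat.Properties.≤-Reasoning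

⟦_⟧ : {P : Fin n → Set} → (∀ x → Dec (P x)) → Subset n
⟦ P? ⟧ = tabulate (does ∘ P?)

∈⟦⟧⁻ : {P : Fin n → Set} (P? : ∀ x → Dec (P x)) → x ∈ ⟦ P? ⟧ → P x
∈⟦⟧⁻ {x = x} P? x∈ with P? x | trans (sym (lookup∘tabulate (does ∘ P?) x)) ([]=⇒lookup x∈)
... | yes Px | _  = Px
... | no  _  | ()

∉⟦⟧⁻ : {P : Fin n → Set} (P? : ∀ x → Dec (P x)) → x ∉ ⟦ P? ⟧ → ¬ P x
∉⟦⟧⁻ {x = x} P? x∉ Px = x∉ (lookup⇒[]= x _ (trans (lookup∘tabulate (does ∘ P?) x) (dec-true (P? x) Px)))

module WeightSums (G : OrderedAbGroup) where
  open OrderedAbGroup G renaming (_≤_ to infix 4 _≼_; _+_ to infixl 6 _⊕_)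
  open IsAbelianGroup isAbelianGroup using (assoc; comm; identityˡ; identityʳ; inverseʳ)
  open IsTotalOrder isTotalOrder using (antisym)
  open ≡-Reasoning

  ⊕-leftComm : ∀ a b c → a ⊕ (b ⊕ c) ≡ b ⊕ (a ⊕ c)
  ⊕-leftComm a b c = begin
    a ⊕ (b ⊕ c)  ≡⟨ sym (assoc a b c) ⟩
    (a ⊕ b) ⊕ c  ≡⟨ cong (_⊕ c) (comm a b) ⟩
    (b ⊕ a) ⊕ c  ≡⟨ assoc b a c ⟩
    b ⊕ (a ⊕ c)  ∎

  ⊕-cancelʳ-≼ : ∀ {a b} c → a ⊕ c ≼ b ⊕ c → a ≼ b
  ⊕-cancelʳ-≼ {a} {b} c le = subst₂ _≼_ (undo a) (undo b) (+-mono-≤ (- c) le)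
    where
    undo : ∀ x → (x ⊕ c) ⊕ - c ≡ x
    undo x = begin
      (x ⊕ c) ⊕ - c  ≡⟨ assoc x c (- c) ⟩
      x ⊕ (c ⊕ - c)  ≡⟨ cong (x ⊕_) (inverseʳ c) ⟩
      x ⊕ 0#         ≡⟨ identityʳ x ⟩
      x              ∎

  nonneg-absorbed : ∀ {a b} → 0# ≼ a → a ⊕ b ≼ b → a ≡ 0#
  nonneg-absorbed {a} {b} 0≼a le =
    antisym (⊕-cancelʳ-≼ b (subst (a ⊕ b ≼_) (sym (identityˡ b)) le)) 0≼a

  wsum-insert : ∀ (w : Fin n → Carrier) x p → x ∉ p → wsum G w (⁅ x ⁆ ∪ p) ≡ w x ⊕ wsum G w p
  wsum-insert w zero    (outside ∷ p) _   = cong (λ q → w zero ⊕ wsum G (w ∘ suc) q) (∪-identityˡ p)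
  wsum-insert w zero    (inside  ∷ p) x∉p = contradiction here x∉p
  wsum-insert w (suc x) (outside ∷ p) x∉p = wsum-insert (w ∘ suc) x p (x∉p ∘ there)
  wsum-insert w (suc x) (inside  ∷ p) x∉p =
    trans (cong (w zero ⊕_) (wsum-insert (w ∘ suc) x p (x∉p ∘ there)))
          (⊕-leftComm (w zero) (w (suc x)) _)

  wsum-remove : ∀ (w : Fin n → Carrier) x p → x ∈ p → wsum G w p ≡ w x ⊕ wsum G w (p - x)
  wsum-remove w zero    (inside  ∷ p) here      = cong (λ q → w zero ⊕ wsum G (w ∘ suc) q) (sym (p─⊥≡p p))
  wsum-remove w (suc x) (outside ∷ p) (there m) = wsum-remove (w ∘ suc) x p m
  wsum-remove w (suc x) (inside  ∷ p) (there m) =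
    trans (cong (w zero ⊕_) (wsum-remove (w ∘ suc) x p m))
          (⊕-leftComm (w zero) (w (suc x)) _)

module Augmentation {n : ℕ} (M : Matroid n) where
  open Matroid M

  Augments : Subset n → Subset n → Subset n → Set
  Augments I J K = Indep K × I ⊆ K × K ⊆ I ∪ J × ∣ J ∣ ≤ ∣ K ∣

  -- Repeated exchange; k bounds the number of elements still to be added.
  augment-within : ∀ k {I J} → Indep I → Indep J → ∣ J ∣ ≤ k + ∣ I ∣ → ∃ (Augments I J)
  augment-within k {I} {J} iI iJ bound with ∣ J ∣ ≤? ∣ I ∣
  ... | yes ∣J∣≤∣I∣ = I , iI , ⊆-refl , p⊆p∪q J , ∣J∣≤∣I∣
  ... | no ∣J∣≰∣I∣ with exchange iI iJ (≰⇒> ∣J∣≰∣I∣) | k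
  ...   | _ | zero = contradiction bound ∣J∣≰∣I∣
  ...   | x , x∈J , x∉I , iI+x | suc k with augment-within k iI+x iJ bound′
    where
    bound′ : ∣ J ∣ ≤ k + ∣ ⁅ x ⁆ ∪ I ∣
    bound′ = ≤-trans bound (≤-reflexive (trans (sym (+-suc k ∣ I ∣))
                                               (cong (k +_) (sym (∣⁅x⁆∪p∣≡1+∣p∣ x I x∉I)))))
  ...     | K , iK , I+x⊆K , K⊆I+x∪J , ∣J∣≤∣K∣ =
    K , iK , I+x⊆K ∘ q⊆p∪q ⁅ x ⁆ I
      , ∪-⊆ (⁅x⁆∪p⊆q (q⊆p∪q I J x∈J) (p⊆p∪q J)) (q⊆p∪q I J) ∘ K⊆I+x∪J
      , ∣J∣≤∣K∣

  augment : ∀ {I J} → Indep I → Indep J → ∃ (Augments I J)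
  augment {I} {J} iI iJ = augment-within ∣ J ∣ iI iJ (m≤m+n ∣ J ∣ ∣ I ∣)

module Optimal (G : OrderedAbGroup) {n : ℕ} (M : Matroid n)
               (w : Fin n → OrderedAbGroup.Carrier G) where
  open OrderedAbGroup G renaming (_≤_ to infix 4 _≼_; _+_ to infixl 6 _⊕_)
  open IsAbelianGroup isAbelianGroup using (identityˡ)
  open IsTotalOrder isTotalOrder using (total)
    renaming (refl to ≼-refl; trans to ≼-trans; antisym to ≼-antisym)
  open Matroid M
  open IsOPT
  open WeightSums G
  open Augmentation M

  private
    variable
      A B O O′ T : Subset n
      e : Fin n

  W : Subset n → Carrier
  W = wsum G w

  NonzeroOn : Subset n → Set
  NonzeroOn T = ∀ {x} → x ∈ T → w x ≢ 0#

  _IsUpperFor_ : Subset n → Subset n → Set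
  T IsUpperFor O = ∀ {x y} → x ∈ T → y ∈ O → y ∉ T → w y ≼ w x

  -- An optimal set has no element of weight zero: dropping it would keep
  -- the weight and decrease the size.
  OPT-nonzero : IsOPT G M w A O → NonzeroOn O
  OPT-nonzero {O = O} opt {x} x∈O wx≡0 =
    <⇒≱ (x∈p⇒∣p-x∣<∣p∣ x∈O) (minCard opt (O - x) (O⊆A opt ∘ O-x⊆O) (indep-⊆ O-x⊆O (O-indep opt)) same-weight)
    where
    open ≡-Reasoning
    O-x⊆O : O - x ⊆ O
    O-x⊆O = p─q⊆p O ⁅ x ⁆
    same-weight : W (O - x) ≡ W O
    same-weight = begin
      W (O - x)        ≡⟨ sym (identityˡ _) ⟩
      0# ⊕ W (O - x)   ≡⟨ cong (_⊕ W (O - x)) (sym wx≡0) ⟩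
      w x ⊕ W (O - x)  ≡⟨ sym (wsum-remove w x O x∈O) ⟩
      W O              ∎

  OPT-no-heavier-swap : IsOPT G M w A O → x ∈ A → x ∉ O → y ∈ O →
                        Indep (⁅ x ⁆ ∪ (O - y)) → w x ≼ w y
  OPT-no-heavier-swap {O = O} {x = x} {y = y} opt x∈A x∉O y∈O indep =
    ⊕-cancelʳ-≼ (W (O - y)) (subst₂ _≼_ (wsum-insert w x (O - y) (x∉O ∘ O-y⊆O)) (wsum-remove w y O y∈O)
                                       (maxW opt _ (⁅x⁆∪p⊆q x∈A (O⊆A opt ∘ O-y⊆O)) indep))
    where
    O-y⊆O : O - y ⊆ O
    O-y⊆O = p─q⊆p O ⁅ y ⁆

  module _ (w≥0 : ∀ e → 0# ≼ w e) where

    OPT-no-extension : IsOPT G M w A O → x ∈ A → x ∉ O → w x ≢ 0# → ¬ Indep (⁅ x ⁆ ∪ O)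
    OPT-no-extension {O = O} {x = x} opt x∈A x∉O wx≢0 indep =
      wx≢0 (nonneg-absorbed (w≥0 x) (subst (_≼ W O) (wsum-insert w x O x∉O)
                                           (maxW opt _ (⁅x⁆∪p⊆q x∈A (O⊆A opt)) indep)))

    module _ (w-inj : Injective _≡_ _≡_ w) where

      -- Inside an upper segment T, O ∩ T cannot be extended by an element of
      -- A ∩ T: augmenting such an extension from O either extends O itself
      -- or trades an element y ∉ T of O for the new, distinct, heavier x.
      upper-blocked : IsOPT G M w A O → NonzeroOn T → T IsUpperFor O →
                      x ∈ A → x ∈ T → x ∉ O → ¬ Indep (⁅ x ⁆ ∪ (O ∩ T))
      upper-blocked {O = O} {T = T} {x = x} opt T≢0 T↑ x∈A x∈T x∉O indep
        with augment indep (O-indep opt)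
      ... | K , iK , I⊆K , K⊆I∪O , ∣O∣≤∣K∣ with ⊆⊎∃∉ O K
      ...   | inj₁ O⊆K =
        OPT-no-extension opt x∈A x∉O (T≢0 x∈T) (indep-⊆ (⁅x⁆∪p⊆q (I⊆K (x∈⁅x⁆∪p _)) O⊆K) iK)
      ...   | inj₂ (y , y∈O , y∉K) = x∉O (subst (_∈ O) (sym x≡y) y∈O)
        where
        K⊆x+O : K ⊆ ⁅ x ⁆ ∪ O
        K⊆x+O = ∪-⊆ (∪-⊆ (p⊆p∪q O) (q⊆p∪q ⁅ x ⁆ O ∘ p∩q⊆p O T)) (q⊆p∪q ⁅ x ⁆ O) ∘ K⊆I∪O
        K⊆swap : K ⊆ ⁅ x ⁆ ∪ (O - y)
        K⊆swap {z} z∈K with ∈⁅x⁆∪p⁻ O (K⊆x+O z∈K)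
        ... | inj₁ refl = x∈⁅x⁆∪p _
        ... | inj₂ z∈O  = q⊆p∪q ⁅ x ⁆ (O - y) (x∈p∧x≢y⇒x∈p-y z∈O λ { refl → y∉K z∈K })
        ∣swap∣≤∣K∣ : ∣ ⁅ x ⁆ ∪ (O - y) ∣ ≤ ∣ K ∣
        ∣swap∣≤∣K∣ = ≤-trans (≤-reflexive (∣⁅x⁆∪p∣≡1+∣p∣ x (O - y) (x∉O ∘ p─q⊆p O ⁅ y ⁆)))
                             (≤-trans (x∈p⇒∣p-x∣<∣p∣ y∈O) ∣O∣≤∣K∣)
        y∉T : y ∉ T
        y∉T y∈T = y∉K (I⊆K (q⊆p∪q ⁅ x ⁆ (O ∩ T) (x∈p∩q⁺ (y∈O , y∈T))))
        x≡y : x ≡ y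
        x≡y = w-inj (≼-antisym (OPT-no-heavier-swap opt x∈A x∉O y∈O (indep-⊆ (⊆-card-⊇ K⊆swap ∣swap∣≤∣K∣) iK))
                               (T↑ x∈T y∈O y∉T))

      upper-rank : IsOPT G M w A O → NonzeroOn T → T IsUpperFor O →
                   ∀ {J} → Indep J → J ⊆ A → J ⊆ T → ∣ J ∣ ≤ ∣ O ∩ T ∣
      upper-rank {O = O} {T = T} opt T≢0 T↑ {J} iJ J⊆A J⊆T with ∣ J ∣ ≤? ∣ O ∩ T ∣
      ... | yes ∣J∣≤ = ∣J∣≤
      ... | no ∣J∣≰ with exchange (indep-⊆ (p∩q⊆p O T) (O-indep opt)) iJ (≰⇒> ∣J∣≰)
      ...   | x , x∈J , x∉O∩T , indep = ⊥-elim
        (upper-blocked opt T≢0 T↑ (J⊆A x∈J) (J⊆T x∈J) (λ x∈O → x∉O∩T (x∈p∩q⁺ (x∈O , J⊆T x∈J))) indep)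

      OPT-size-mono : A ⊆ B → IsOPT G M w B O → IsOPT G M w A O′ → ∣ O′ ∣ ≤ ∣ O ∣
      OPT-size-mono {O = O} {O′ = O′} A⊆B opt opt′ =
        ≤-trans (upper-rank opt nonzero upper (O-indep opt′) (A⊆B ∘ O⊆A opt′) (q⊆p∪q O O′))
                (∣p∩q∣≤∣p∣ O (O ∪ O′))
        where
        nonzero : NonzeroOn (O ∪ O′)
        nonzero x∈ with x∈p∪q⁻ O O′ x∈
        ... | inj₁ x∈O  = OPT-nonzero opt x∈O
        ... | inj₂ x∈O′ = OPT-nonzero opt′ x∈O′
        upper : (O ∪ O′) IsUpperFor O
        upper _ y∈O y∉ = contradiction (p⊆p∪q O′ y∈O) y∉

      _⊏_ : Fin n → Fin n → Set
      e ⊏ x = w e ≼ w x × x ≢ e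

      _⊏?_ : ∀ e x → Dec (e ⊏ x)
      e ⊏? x with x ≟ e
      ... | yes refl = no λ (_ , x≢x) → x≢x refl
      ... | no x≢e with total (w e) (w x)
      ...   | inj₁ we≼wx = yes (we≼wx , x≢e)
      ...   | inj₂ wx≼we = no λ (we≼wx , _) → x≢e (w-inj (≼-antisym wx≼we we≼wx))

      Above AtLeast : Fin n → Subset n
      Above e   = ⟦ e ⊏?_ ⟧
      AtLeast e = ⁅ e ⁆ ∪ Above e

      e∉Above : e ∉ Above e
      e∉Above {e = e} e∈ with ∈⟦⟧⁻ (e ⊏?_) e∈
      ... | _ , e≢e = e≢e refl

      ∉Above⇒≼ : y ∉ Above e → w y ≼ w e
      ∉Above⇒≼ {y = y} {e = e} y∉ with y ≟ e
      ... | yes refl = ≼-refl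
      ... | no y≢e with total (w y) (w e)
      ...   | inj₁ wy≼we = wy≼we
      ...   | inj₂ we≼wy = contradiction (we≼wy , y≢e) (∉⟦⟧⁻ (e ⊏?_) y∉)

      ∈AtLeast⇒≼ : x ∈ AtLeast e → w e ≼ w x
      ∈AtLeast⇒≼ {e = e} x∈ with ∈⁅x⁆∪p⁻ (Above e) x∈
      ... | inj₁ refl = ≼-refl
      ... | inj₂ x∈Above with ∈⟦⟧⁻ (e ⊏?_) x∈Above
      ...   | we≼wx , _ = we≼wx

      separated-upper : ∀ e → (∀ {x} → x ∈ T → w e ≼ w x) → (∀ {y} → y ∉ T → w y ≼ w e) →
                        T IsUpperFor O
      separated-upper e above below x∈T _ y∉T = ≼-trans (below y∉T) (above x∈T)

      AtLeast-upper : AtLeast e IsUpperFor O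
      AtLeast-upper {e = e} = separated-upper e ∈AtLeast⇒≼ (λ y∉ → ∉Above⇒≼ (y∉ ∘ q⊆p∪q ⁅ e ⁆ (Above e)))

      Above-upper : Above e IsUpperFor O
      Above-upper {e = e} = separated-upper e (∈AtLeast⇒≼ ∘ q⊆p∪q ⁅ e ⁆ (Above e)) ∉Above⇒≼

      AtLeast-nonzero : w e ≢ 0# → NonzeroOn (AtLeast e)
      AtLeast-nonzero {e = e} we≢0 x∈ wx≡0 =
        we≢0 (≼-antisym (subst (w e ≼_) wx≡0 (∈AtLeast⇒≼ x∈)) (w≥0 e))

      -- If e ∈ OPT(B) and A ⊆ B, then e is independent of the part of OPT(A)
      -- strictly heavier than e: otherwise augmenting that part from
      -- e + (OPT(B) ∩ Above e) would exceed the rank of Above e inside B.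
      heavy-part-extends : A ⊆ B → IsOPT G M w B O → IsOPT G M w A O′ → e ∈ O →
                           Indep (⁅ e ⁆ ∪ (O′ ∩ Above e))
      heavy-part-extends {B = B} {O = O} {O′ = O′} {e = e} A⊆B opt opt′ e∈O =
        extend (augment (indep-⊆ (p∩q⊆p O′ (Above e)) (O-indep opt′)) (indep-⊆ X⊆O (O-indep opt)))
        where
        I X : Subset n
        I = O′ ∩ Above e
        X = ⁅ e ⁆ ∪ (O ∩ Above e)
        X⊆O : X ⊆ O
        X⊆O = ⁅x⁆∪p⊆q e∈O (p∩q⊆p O (Above e))
        extend : ∃ (Augments I X) → Indep (⁅ e ⁆ ∪ I)
        extend (K , iK , I⊆K , K⊆I∪X , ∣X∣≤∣K∣) with e ∈? K
        ... | yes e∈K = indep-⊆ (⁅x⁆∪p⊆q e∈K I⊆K) iK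
        ... | no e∉K  = contradiction (upper-rank opt Above-nonzero Above-upper iK K⊆B K⊆Above)
                                      (<⇒≱ ∣O∩Above∣<∣K∣)
          where
          Above-nonzero : NonzeroOn (Above e)
          Above-nonzero = AtLeast-nonzero (OPT-nonzero opt e∈O) ∘ q⊆p∪q ⁅ e ⁆ (Above e)
          K⊆B : K ⊆ B
          K⊆B = ∪-⊆ (A⊆B ∘ O⊆A opt′ ∘ p∩q⊆p O′ (Above e)) (O⊆A opt ∘ X⊆O) ∘ K⊆I∪X
          K⊆Above : K ⊆ Above e
          K⊆Above z∈K with x∈p∪q⁻ I X (K⊆I∪X z∈K)
          ... | inj₁ z∈I = p∩q⊆q O′ (Above e) z∈I
          ... | inj₂ z∈X with ∈⁅x⁆∪p⁻ (O ∩ Above e) z∈X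
          ...   | inj₁ refl       = contradiction z∈K e∉K
          ...   | inj₂ z∈O∩Above = p∩q⊆q O (Above e) z∈O∩Above
          ∣O∩Above∣<∣K∣ : ∣ O ∩ Above e ∣ < ∣ K ∣
          ∣O∩Above∣<∣K∣ = ≤-trans (≤-reflexive (sym (∣⁅x⁆∪p∣≡1+∣p∣ e _ (e∉Above ∘ p∩q⊆q O (Above e)))))
                                  ∣X∣≤∣K∣

      -- (restrict) An element of OPT(B) lying in A ⊆ B belongs to OPT(A):
      -- otherwise e + (OPT(A) ∩ Above e) would be an independent subset of
      -- A ∩ AtLeast e larger than OPT(A) ∩ AtLeast e.
      OPT-restrict : A ⊆ B → IsOPT G M w B O → IsOPT G M w A O′ → e ∈ O → e ∈ A → e ∈ O′
      OPT-restrict {O = O} {O′ = O′} {e = e} A⊆B opt opt′ e∈O e∈A = decidable-stable (e ∈? O′) kept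
        where
        I J : Subset n
        I = O′ ∩ Above e
        J = ⁅ e ⁆ ∪ I
        J⊆AtLeast : J ⊆ AtLeast e
        J⊆AtLeast = ⁅x⁆∪p⊆q (x∈⁅x⁆∪p (Above e)) (q⊆p∪q ⁅ e ⁆ (Above e) ∘ p∩q⊆q O′ (Above e))
        J-rank : ∣ J ∣ ≤ ∣ O′ ∩ AtLeast e ∣
        J-rank = upper-rank opt′ (AtLeast-nonzero (OPT-nonzero opt e∈O)) AtLeast-upper
                   (heavy-part-extends A⊆B opt opt′ e∈O) (⁅x⁆∪p⊆q e∈A (O⊆A opt′ ∘ p∩q⊆p O′ (Above e)))
                   J⊆AtLeast
        kept : ¬ e ∉ O′
        kept e∉O′ = <⇒≱ (≤-trans ∣I∣<∣J∣ J-rank) (p⊆q⇒∣p∣≤∣q∣ AtLeast-part⊆I)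
          where
          ∣I∣<∣J∣ : ∣ I ∣ < ∣ J ∣
          ∣I∣<∣J∣ = ≤-reflexive (sym (∣⁅x⁆∪p∣≡1+∣p∣ e I (e∉O′ ∘ p∩q⊆p O′ (Above e))))
          AtLeast-part⊆I : O′ ∩ AtLeast e ⊆ I
          AtLeast-part⊆I z∈ with x∈p∩q⁻ O′ (AtLeast e) z∈
          ... | z∈O′ , z∈AtLeast with ∈⁅x⁆∪p⁻ (Above e) z∈AtLeast
          ...   | inj₁ refl     = contradiction z∈O′ e∉O′
          ...   | inj₂ z∈Above = x∈p∩q⁺ (z∈O′ , z∈Above)

lemma6 : (G : OrderedAbGroup) (n : ℕ) (M : Matroid n)
         (w : Fin n → OrderedAbGroup.Carrier G) →
         (∀ e → OrderedAbGroup._≤_ G (OrderedAbGroup.0# G) (w e)) →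
         Injective _≡_ _≡_ w →
         (S F O₁ O₂ : Subset n) →
         IsOPT G M w (S ∪ F) O₁ → IsOPT G M w S O₂ →
         ∣ F ∩ O₂ ∣ ≤ ∣ F ∩ O₁ ∣
lemma6 G n M w w≥0 w-inj S F O₁ O₂ opt₁ opt₂ =
  ∣F∩q∣≤∣F∩p∣ F (OPT-size-mono w≥0 w-inj S⊆S∪F opt₁ opt₂) outside-F
  where
  open Optimal G M w
  S⊆S∪F : S ⊆ S ∪ F
  S⊆S∪F = p⊆p∪q F
  -- Outside F, the elements of O₁ lie in S and hence stay optimal for S.
  outside-F : ∁ F ∩ O₁ ⊆ ∁ F ∩ O₂
  outside-F x∈ with x∈p∩q⁻ (∁ F) O₁ x∈
  ... | x∈∁F , x∈O₁ with x∈p∪q⁻ S F (IsOPT.O⊆A opt₁ x∈O₁)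
  ...   | inj₁ x∈S = x∈p∩q⁺ (x∈∁F , OPT-restrict w≥0 w-inj S⊆S∪F opt₁ opt₂ x∈O₁ x∈S)
  ...   | inj₂ x∈F = contradiction x∈F (x∈∁p⇒x∉p x∈∁F)
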